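{- Let $n\ge 6$ be even, and let $d_*=(\epsilon_1,\dots,\epsilon_{n-1},h)$ and $d_*'=(\epsilon_1',\dots,\epsilon_{n-1}',h')$ be neighbors. Then for each $j\in[1,n-1]$, $\epsilon_j=1$ implies $\epsilon'_j\ne -1$, and $\epsilon_j=-1$ implies $\epsilon'_j\neq 1$; equivalently, $|\epsilon_j-\epsilon'_j|\le 1$ for every $j\in[1,n-1]$.
   Context: $\mathrm{dist}(a,b)$ is the minimum of the residues in $[0,n-1]$ of $a-b$ and $b-a$ mod $n$. A Latin row $(s_1,\dots,s_n)$ is a permutation of $[1,n]$; it is normal if $s_1=1$ and has maximum inner distance if $\mathrm{dist}(s_j,s_{j+1})\ge\frac n2-1$ for $j\le n-1$. With $h_j\in[0,n-1]$, $h_j\equiv s_{j+1}-s_j$ ($j\le n-1$), $h_n\in[0,n-1]$, $h_n\equiv s_1-s_n$, the extended difference row is $(\epsilon_1,\dots,\epsilon_{n-1},h)$ with $\epsilon_j=h_j-\frac n2\in\{ -1,0,1\}$, $h=h_n-\frac n2$ (integers). Two extended difference rows $d_*,d_*'$ of normal rows $r,r'$ of maximum inner distance are neighbors if some additions of $r$ and $r'$ (adding a constant to all entries mod $n$) stacked as two rows form a $2\times n$ Latin rectangle (no symbol repeated in a row or column) in which every pair of horizontally or vertically adjacent symbols has distance at least $\frac n2-1$. -}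

module Defs where

open import Data.Nat using (ℕ; zero; suc; _≤_; _∸_; _⊓_; ⌊_/2⌋; NonZero)
open import Data.Integer using (ℤ; +_; _-_; _+_; _%ℕ_)
open import Data.Fin using (Fin; toℕ)
open import Data.Product using (Σ; _×_; ∃)
open import Relation.Binary.PropositionalEquality using (_≡_; _≢_)

-- Symbols are natural numbers; a row of length n is a function Fin n → ℕ
-- (position i : Fin n corresponds to index toℕ i + 1 of the paper).
Row : ℕ → Set
Row n = Fin n → ℕ

dist : (n : ℕ) → .{{NonZero n}} → ℕ → ℕ → ℕ
dist n a b = ((+ a - + b) %ℕ n) ⊓ ((+ b - + a) %ℕ n)

LatinRow : (n : ℕ) → Row n → Set
LatinRow n s =
  ((i : Fin n) → 1 ≤ s i × s i ≤ n) ×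
  ((i j : Fin n) → s i ≡ s j → i ≡ j) ×
  ((v : ℕ) → 1 ≤ v → v ≤ n → ∃ λ (i : Fin n) → s i ≡ v)

Normal : (n : ℕ) → Row n → Set
Normal n s = (i : Fin n) → toℕ i ≡ 0 → s i ≡ 1

Adj : {n : ℕ} → Fin n → Fin n → Set
Adj j j' = toℕ j' ≡ suc (toℕ j)

Far : (n : ℕ) → .{{NonZero n}} → ℕ → ℕ → Set
Far n a b = ⌊ n /2⌋ ∸ 1 ≤ dist n a b

MaxInnerDist : (n : ℕ) → .{{NonZero n}} → Row n → Set
MaxInnerDist n s = (j j' : Fin n) → Adj j j' → Far n (s j) (s j')

addRow : (n : ℕ) → .{{NonZero n}} → ℕ → Row n → Row n
addRow n c s i = suc ((+ s i - + 1 + + c) %ℕ n)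

hDiff : (n : ℕ) → .{{NonZero n}} → ℕ → ℕ → ℕ
hDiff n a b = (+ b - + a) %ℕ n

epsilon : (n : ℕ) → .{{NonZero n}} → Row n → (j j' : Fin n) → ℤ
epsilon n s j j' = + hDiff n (s j) (s j') - + ⌊ n /2⌋

GoodRectangle : (n : ℕ) → .{{NonZero n}} → Row n → Row n → Set
GoodRectangle n t t' =
  LatinRow n t × LatinRow n t' ×
  ((i : Fin n) → t i ≢ t' i) ×
  ((j j' : Fin n) → Adj j j' → Far n (t j) (t j')) ×
  ((j j' : Fin n) → Adj j j' → Far n (t' j) (t' j')) ×
  ((i : Fin n) → Far n (t i) (t' i))

-- The extended difference rows of normal rows r, r' of maximum inner
-- distance are neighbors (expressed on the rows r, r', which determine
-- and are determined by their extended difference rows).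
Neighbors : (n : ℕ) → .{{NonZero n}} → Row n → Row n → Set
Neighbors n r r' =
  Σ ℕ λ c → Σ ℕ λ c' → GoodRectangle n (addRow n c r) (addRow n c' r')

module Submission where

-- Write n = 2m.  In a row of maximum inner distance consecutive entries differ
-- by m + ε with ε ∈ {-1, 0, 1}, so a row is a walk whose positions i·m + Σ ε,
-- lifted to ℤ, are pairwise distinct modulo n.  Hence no two and no four
-- consecutive steps cancel, and a count of where s₁ + m can sit shows that no
-- row starts with the steps 1, 0, 1.  In a good rectangle the two entries of a
-- column differ by m + c with c ∈ {-1, 0, 1}, and going around a square shows
-- c_{j+1} − c_j = ε′_j − ε_j.  So a crossing ε_j = -1, ε′_j = 1 forces
-- c_j = -1, c_{j+1} = 1 and flat steps on both sides of it, and then a second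
-- crossing two columns further on, where c would have to be -1 again although
-- the flat steps keep it at 1.  At the start of the row the forbidden prefix
-- 1, 0, 1 produces two opposite crossings in a row instead, and the end of the
-- row is the start of the reversed rectangle.

open import Defs
open import Data.Empty using (⊥; ⊥-elim)
open import Data.Fin using (Fin; toℕ; fromℕ<)
import Data.Fin.Properties as FP
open import Data.Integer as ℤ using (ℤ; +_; -_; -[1+_]; +[1+_]; _+_; _*_; _-_; ∣_∣; _%ℕ_; _/ℕ_)
import Data.Integer.DivMod as ℤDM
open import Data.Integer.Divisibility.Signed as ℤ∣ using (divides; ∣-trans; m∣∣m∣; ∣m∣n⇒∣m+n; ∣m⇒∣-m)
import Data.Integer.Properties as ℤP
open import Data.Integer.Tactic.RingSolver using (solve-∀)
open import Data.Nat as ℕ using (ℕ; zero; suc; NonZero; _<_; _≤_; s≤s; z≤n; _∸_; _⊓_; ⌊_/2⌋)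
open import Data.Nat.Divisibility as ℕ∣ using (_∣_)
import Data.Nat.Properties as ℕP
import Data.Nat.Tactic.RingSolver as ℕSolver
open import Data.Product using (∃; _×_; _,_; proj₁; proj₂)
open import Data.Sum using (_⊎_; inj₁; inj₂)
open import Function using (_∘_)
open import Level using (0ℓ)
open import Relation.Binary.Bundles using (Setoid)
open import Relation.Binary.Definitions using (tri<; tri≈; tri>)
open import Relation.Binary.PropositionalEquality
import Relation.Binary.Reasoning.Setoid as SetoidReasoning
open import Relation.Nullary using (¬_; yes; no)

data Step : Set where
  down flat up : Step

⟦_⟧ : Step → ℤ
⟦ down ⟧ = -[1+ 0 ]
⟦ flat ⟧ = + 0
⟦ up ⟧   = + 1

neg : Step → Step
neg down = up
neg flat = flat
neg up   = down

⟦neg⟧ : ∀ s → ⟦ neg s ⟧ ≡ - ⟦ s ⟧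
⟦neg⟧ down = refl
⟦neg⟧ flat = refl
⟦neg⟧ up   = refl

⟦⟧-injective : ∀ {s t} → ⟦ s ⟧ ≡ ⟦ t ⟧ → s ≡ t
⟦⟧-injective {down} {down} _ = refl
⟦⟧-injective {flat} {flat} _ = refl
⟦⟧-injective {up}   {up}   _ = refl
⟦⟧-injective {down} {flat} ()
⟦⟧-injective {down} {up}   ()
⟦⟧-injective {flat} {down} ()
⟦⟧-injective {flat} {up}   ()
⟦⟧-injective {up}   {down} ()
⟦⟧-injective {up}   {flat} ()

up≢down : up ≢ down
up≢down ()

∣⟦s⟧∣≤1 : ∀ s → ∣ ⟦ s ⟧ ∣ ≤ 1
∣⟦s⟧∣≤1 down = ℕP.≤-refl
∣⟦s⟧∣≤1 flat = z≤n
∣⟦s⟧∣≤1 up   = ℕP.≤-refl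

≢flat,down⇒up : ∀ {s} → s ≢ flat → s ≢ down → s ≡ up
≢flat,down⇒up {down} _ s≢down = ⊥-elim (s≢down refl)
≢flat,down⇒up {flat} s≢flat _ = ⊥-elim (s≢flat refl)
≢flat,down⇒up {up}   _ _      = refl

≢flat,up⇒down : ∀ {s} → s ≢ flat → s ≢ up → s ≡ down
≢flat,up⇒down {down} _ _      = refl
≢flat,up⇒down {flat} s≢flat _ = ⊥-elim (s≢flat refl)
≢flat,up⇒down {up}   _ s≢up   = ⊥-elim (s≢up refl)

ColumnStep : Step → Step → Step → Step → Set
ColumnStep c c′ a b = ⟦ c′ ⟧ ≡ ⟦ c ⟧ + ⟦ a ⟧ - ⟦ b ⟧

column-up-down : ∀ {c c′} → ColumnStep c c′ up down → c ≡ down × c′ ≡ up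
column-up-down {down} {up}   _ = refl , refl
column-up-down {down} {down} ()
column-up-down {down} {flat} ()
column-up-down {flat} {down} ()
column-up-down {flat} {flat} ()
column-up-down {flat} {up}   ()
column-up-down {up}   {down} ()
column-up-down {up}   {flat} ()
column-up-down {up}   {up}   ()

column-down-up : ∀ {c c′} → ColumnStep c c′ down up → c ≡ up × c′ ≡ down
column-down-up {up}   {down} _ = refl , refl
column-down-up {down} {down} ()
column-down-up {down} {flat} ()
column-down-up {down} {up}   ()
column-down-up {flat} {down} ()
column-down-up {flat} {flat} ()
column-down-up {flat} {up}   ()
column-down-up {up}   {flat} ()
column-down-up {up}   {up}   ()

column-flat : ∀ {c c′} → ColumnStep c c′ flat flat → c′ ≡ c
column-flat {c} eq = ⟦⟧-injective (trans eq (trans (ℤP.+-identityʳ _) (ℤP.+-identityʳ ⟦ c ⟧)))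

column-after-up : ∀ {c′ a b} → a ≢ down → b ≢ up → ColumnStep up c′ a b → a ≡ flat × b ≡ flat
column-after-up {a = down} a≢down _ _ = ⊥-elim (a≢down refl)
column-after-up {b = up}   _ b≢up _   = ⊥-elim (b≢up refl)
column-after-up {a = flat} {flat} _ _ _ = refl , refl
column-after-up {down} {flat} {down} _ _ ()
column-after-up {flat} {flat} {down} _ _ ()
column-after-up {up}   {flat} {down} _ _ ()
column-after-up {down} {up}   {down} _ _ ()
column-after-up {flat} {up}   {down} _ _ ()
column-after-up {up}   {up}   {down} _ _ ()
column-after-up {down} {up}   {flat} _ _ ()
column-after-up {flat} {up}   {flat} _ _ ()
column-after-up {up}   {up}   {flat} _ _ ()

column-before-down : ∀ {c a b} → a ≢ down → b ≢ up → ColumnStep c down a b → a ≡ flat × b ≡ flat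
column-before-down {a = down} a≢down _ _ = ⊥-elim (a≢down refl)
column-before-down {b = up}   _ b≢up _   = ⊥-elim (b≢up refl)
column-before-down {c} {flat} {flat} _ _ _ = refl , refl
column-before-down {down} {flat} {down} _ _ ()
column-before-down {flat} {flat} {down} _ _ ()
column-before-down {up}   {flat} {down} _ _ ()
column-before-down {down} {up}   {down} _ _ ()
column-before-down {flat} {up}   {down} _ _ ()
column-before-down {up}   {up}   {down} _ _ ()
column-before-down {down} {up}   {flat} _ _ ()
column-before-down {flat} {up}   {flat} _ _ ()
column-before-down {up}   {up}   {flat} _ _ ()

even-or-odd : ∀ d → ∃ λ s → d ≡ 2 ℕ.* s ⊎ d ≡ suc (2 ℕ.* s)
even-or-odd zero = 0 , inj₁ refl
even-or-odd (suc d) with even-or-odd d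
... | s , inj₁ refl = s , inj₂ refl
... | s , inj₂ refl = suc s , inj₁ (cong suc (sym (ℕP.+-suc s (s ℕ.+ 0))))

module EvenOrder (k : ℕ) where

  m n : ℕ
  m = 3 ℕ.+ k
  n = m ℕ.+ m

  M N : ℤ
  M = + m
  N = + n

  0<n : 0 < n
  0<n = s≤s z≤n

  m<n : m < n
  m<n = ℕP.m<m+n m (s≤s z≤n)

  six≤n : 6 ≤ n
  six≤n = ℕP.+-mono-≤ (ℕP.m≤m+n 3 k) (ℕP.m≤m+n 3 k)

  4<n : 4 < n
  4<n = ℕP.<-≤-trans (ℕP.n<1+n 4) (ℕP.<⇒≤ six≤n)

  -- Congruence modulo n

  infix 4 _≈_
  record _≈_ (a b : ℤ) : Set where
    constructor mod-n
    field n∣a-b : N ℤ∣.∣ a - b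

  N∣+x⇒x≡0 : ∀ {x} → x < n → N ℤ∣.∣ + x → x ≡ 0
  N∣+x⇒x≡0 _   (divides (+ 0)     eq) = ℤP.+-injective eq
  N∣+x⇒x≡0 x<n (divides +[1+ q ]  eq) =
    ⊥-elim (ℕP.<⇒≱ x<n (ℕP.≤-trans (ℕP.m≤m+n n _) (ℕP.≤-reflexive (sym (ℤP.+-injective eq)))))
  N∣+x⇒x≡0 _   (divides -[1+ q ] ())

  N∣x⇒x≡0 : ∀ {x} → ∣ x ∣ < n → N ℤ∣.∣ x → x ≡ + 0
  N∣x⇒x≡0 lt N∣x = ℤP.∣i∣≡0⇒i≡0 (N∣+x⇒x≡0 lt (∣-trans N∣x m∣∣m∣))

  ∣a-b∣<n : ∀ {a b} → a < n → b < n → ∣ + a - + b ∣ < n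
  ∣a-b∣<n {a} {b} a<n b<n with ℕP.≤-total a b
  ... | inj₁ a≤b rewrite ℤP.[+m]-[+n]≡m⊖n a b | ℤP.∣⊖∣-≤ a≤b = ℕP.≤-<-trans (ℕP.m∸n≤m b a) b<n
  ... | inj₂ b≤a rewrite ℤP.∣i-j∣≡∣j-i∣ (+ a) (+ b) | ℤP.[+m]-[+n]≡m⊖n b a | ℤP.∣⊖∣-≤ b≤a =
    ℕP.≤-<-trans (ℕP.m∸n≤m a b) a<n

  residue-unique : ∀ {a b} → a < n → b < n → + a ≈ + b → a ≡ b
  residue-unique {a} {b} a<n b<n (mod-n N∣a-b) =
    ℤP.+-injective (ℤP.i-j≡0⇒i≡j (+ a) (+ b) (N∣x⇒x≡0 (∣a-b∣<n a<n b<n) N∣a-b))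

  ≈-refl : ∀ {a} → a ≈ a
  ≈-refl {a} = mod-n (divides (+ 0) (ℤP.+-inverseʳ a))

  ≈-sym : ∀ {a b} → a ≈ b → b ≈ a
  ≈-sym {a} {b} (mod-n N∣a-b) = mod-n (subst (N ℤ∣.∣_) (negate-difference a b) (∣m⇒∣-m N∣a-b))
    where
    negate-difference : ∀ a b → - (a - b) ≡ b - a
    negate-difference = solve-∀

  ≈-trans : ∀ {a b c} → a ≈ b → b ≈ c → a ≈ c
  ≈-trans {a} {b} {c} (mod-n N∣a-b) (mod-n N∣b-c) = mod-n (subst (N ℤ∣.∣_) (telescope a b c) (∣m∣n⇒∣m+n N∣a-b N∣b-c))
    where
    telescope : ∀ a b c → (a - b) + (b - c) ≡ a - c
    telescope = solve-∀

  ≈-reflexive : ∀ {a b} → a ≡ b → a ≈ b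
  ≈-reflexive refl = ≈-refl

  ≈-+ : ∀ {a b c d} → a ≈ b → c ≈ d → a + c ≈ b + d
  ≈-+ {a} {b} {c} {d} (mod-n N∣a-b) (mod-n N∣c-d) = mod-n (subst (N ℤ∣.∣_) (regroup a b c d) (∣m∣n⇒∣m+n N∣a-b N∣c-d))
    where
    regroup : ∀ a b c d → (a - b) + (c - d) ≡ a + c - (b + d)
    regroup = solve-∀

  ≈-neg : ∀ {a b} → a ≈ b → - a ≈ - b
  ≈-neg {a} {b} (mod-n N∣a-b) = mod-n (subst (N ℤ∣.∣_) (regroup a b) (∣m⇒∣-m N∣a-b))
    where
    regroup : ∀ a b → - (a - b) ≡ - a - - b
    regroup = solve-∀

  ≈-setoid : Setoid 0ℓ 0ℓ
  ≈-setoid = record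
    { Carrier       = ℤ
    ; _≈_           = _≈_
    ; isEquivalence = record { refl = ≈-refl ; sym = ≈-sym ; trans = ≈-trans }
    }

  module ≈-Reasoning = SetoidReasoning ≈-setoid

  ≈-cancelˡ : ∀ a {x y} → a + x ≈ a + y → x ≈ y
  ≈-cancelˡ a {x} {y} (mod-n N∣) = mod-n (subst (N ℤ∣.∣_) (cancel a x y) N∣)
    where
    cancel : ∀ a x y → a + x - (a + y) ≡ x - y
    cancel = solve-∀

  complement-≈ : ∀ {x} → x ≤ n → - + x ≈ + (n ∸ x)
  complement-≈ {x} x≤n = mod-n (divides (- + 1) (begin
    - + x - + (n ∸ x)            ≡⟨ regroup (+ x) (+ (n ∸ x)) ⟩
    - + 1 * (+ (n ∸ x) + + x)    ≡⟨ cong (λ y → - + 1 * + y) (ℕP.m∸n+n≡m x≤n) ⟩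
    - + 1 * N                    ∎))
    where
    open ≡-Reasoning
    regroup : ∀ x y → - x - y ≡ - + 1 * (y + x)
    regroup = solve-∀

  -M≈M : - M ≈ M
  -M≈M = mod-n (divides (- + 1) (double M))
    where
    double : ∀ M → - M - M ≡ - + 1 * (M + M)
    double = solve-∀

  %ℕ-≈ : ∀ x → + (x %ℕ n) ≈ x
  %ℕ-≈ x = mod-n (divides (- (x /ℕ n)) (begin
    + (x %ℕ n) - x                              ≡⟨ cong (λ y → + (x %ℕ n) - y) (ℤDM.a≡a%ℕn+[a/ℕn]*n x n) ⟩
    + (x %ℕ n) - (+ (x %ℕ n) + x /ℕ n * N)      ≡⟨ cancel (+ (x %ℕ n)) (x /ℕ n) N ⟩
    - (x /ℕ n) * N                              ∎))
    where
    open ≡-Reasoning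
    cancel : ∀ r q N → r - (r + q * N) ≡ - q * N
    cancel = solve-∀

  %ℕ-cong : ∀ {x y} → x ≈ y → x %ℕ n ≡ y %ℕ n
  %ℕ-cong {x} {y} x≈y = residue-unique (ℤDM.n%ℕd<d x n) (ℤDM.n%ℕd<d y n)
    (≈-trans (%ℕ-≈ x) (≈-trans x≈y (≈-sym (%ℕ-≈ y))))

  -- Rows as step sequences

  drift : (ℕ → Step) → ℕ → ℤ
  drift e zero    = + 0
  drift e (suc i) = drift e i + ⟦ e i ⟧

  drift-step : ∀ e {i s} → e i ≡ s → drift e (suc i) ≡ drift e i + ⟦ s ⟧
  drift-step e {i} = cong (λ s → drift e i + ⟦ s ⟧)

  drift-before : ∀ e {i s y} → e i ≡ s → drift e (suc i) ≡ y → drift e i ≡ y - ⟦ s ⟧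
  drift-before e {i} {s} {y} eᵢ≡s D≡y = begin
    drift e i                           ≡⟨ unshift (drift e i) ⟦ s ⟧ ⟩
    drift e i + ⟦ s ⟧ - ⟦ s ⟧          ≡⟨ cong (_- ⟦ s ⟧) (trans (sym (drift-step e eᵢ≡s)) D≡y) ⟩
    y - ⟦ s ⟧                           ∎
    where
    open ≡-Reasoning
    unshift : ∀ x a → x ≡ x + a - a
    unshift = solve-∀

  position : (ℕ → Step) → ℕ → ℤ
  position e i = + i * M + drift e i

  -- e j is the step ε_{j+1} of a row s, so that position e i lifts s_{i+1} − s₁ to ℤ;
  -- the fields say that s is injective and that every s_p + m occurs in s.
  record IsRow (e : ℕ → Step) : Set where
    field
      injective : ∀ {i j} → i < n → j < n → position e i ≈ position e j → i ≡ j
      covers    : ∀ {p} → p < n → ∃ λ i → i < n × position e i ≈ position e p + M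

  positions-≈ : ∀ e {i j} d q → i ≡ d ℕ.+ j → + d * M + drift e i - drift e j ≡ q * N →
               position e i ≈ position e j
  positions-≈ e {j = j} d q refl eq = mod-n (divides q (begin
    position e (d ℕ.+ j) - position e j
      ≡⟨ cong (λ x → x * M + drift e (d ℕ.+ j) - position e j) (ℤP.pos-+ d j) ⟩
    (+ d + + j) * M + drift e (d ℕ.+ j) - (+ j * M + drift e j)
      ≡⟨ rearrange (+ d) (+ j) M (drift e (d ℕ.+ j)) (drift e j) ⟩
    + d * M + drift e (d ℕ.+ j) - drift e j
      ≡⟨ eq ⟩
    q * N ∎))
    where
    open ≡-Reasoning
    rearrange : ∀ D J M x y → (D + J) * M + x - (J * M + y) ≡ D * M + x - y
    rearrange = solve-∀

  even-position : ∀ e {i} s → i ≡ 2 ℕ.* s → position e i ≈ drift e i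
  even-position e s refl = mod-n (divides (+ s) (begin
    + (2 ℕ.* s) * M + D - D   ≡⟨ cong (λ j → j * M + D - D) (ℤP.pos-* 2 s) ⟩
    + 2 * + s * M + D - D     ≡⟨ cancel (+ s) M D ⟩
    + s * N                   ∎))
    where
    open ≡-Reasoning
    D : ℤ
    D = drift e (2 ℕ.* s)
    cancel : ∀ S M x → + 2 * S * M + x - x ≡ S * (M + M)
    cancel = solve-∀

  +1+2s : ∀ s → + suc (2 ℕ.* s) ≡ + 1 + + 2 * + s
  +1+2s s = trans (ℤP.pos-+ 1 (2 ℕ.* s)) (cong (λ x → + 1 + x) (ℤP.pos-* 2 s))

  odd-position : ∀ e {i} s → i ≡ suc (2 ℕ.* s) → position e i ≈ M + drift e i
  odd-position e s refl = mod-n (divides (+ s) (begin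
    + suc (2 ℕ.* s) * M + D - (M + D)   ≡⟨ cong (λ j → j * M + D - (M + D)) (+1+2s s) ⟩
    (+ 1 + + 2 * + s) * M + D - (M + D) ≡⟨ cancel (+ s) M D ⟩
    + s * N                             ∎))
    where
    open ≡-Reasoning
    D : ℤ
    D = drift e (suc (2 ℕ.* s))
    cancel : ∀ S M x → (+ 1 + + 2 * S) * M + x - (M + x) ≡ S * (M + M)
    cancel = solve-∀

  2a<n⇒1+2a<n : ∀ a → 2 ℕ.* a < n → suc (2 ℕ.* a) < n
  2a<n⇒1+2a<n a lt with suc (2 ℕ.* a) ℕ.<? n
  ... | yes ok = ok
  ... | no ¬lt = ⊥-elim (ℕP.even≢odd m a (trans (sym n≡2m) (ℕP.≤-antisym (ℕP.≮⇒≥ ¬lt) lt)))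
    where
    n≡2m : n ≡ 2 ℕ.* m
    n≡2m = cong (m ℕ.+_) (sym (ℕP.+-identityʳ m))

  module RowConstraints {e : ℕ → Step} (R : IsRow e) where
    open IsRow R

    private
      smaller : ∀ {i j} d → i ≡ d ℕ.+ j → i < n → j < n
      smaller {j = j} d refl i<n = ℕP.≤-<-trans (ℕP.m≤n+m j d) i<n

    even-gap⇒drift≢ : ∀ {i j} s → i ≡ 2 ℕ.* suc s ℕ.+ j → i < n → drift e i ≢ drift e j
    even-gap⇒drift≢ {i} {j} s i≡ i<n Di≡Dj =
      ℕP.m≢1+n+m j (trans (sym (injective i<n (smaller _ i≡ i<n) i≈j)) i≡)
      where
      open ≡-Reasoning
      cancel : ∀ S M x → + 2 * S * M + x - x ≡ S * (M + M)
      cancel = solve-∀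
      i≈j : position e i ≈ position e j
      i≈j = positions-≈ e (2 ℕ.* suc s) (+ suc s) i≡ (begin
        + (2 ℕ.* suc s) * M + drift e i - drift e j ≡⟨ cong₂ (λ x y → x * M + y - drift e j) (ℤP.pos-* 2 (suc s)) Di≡Dj ⟩
        + 2 * + suc s * M + drift e j - drift e j   ≡⟨ cancel (+ suc s) M (drift e j) ⟩
        + suc s * N                                 ∎)

    odd-gap⇒drift≢+m : ∀ {i j} s → i ≡ suc (2 ℕ.* s) ℕ.+ j → i < n → drift e i ≢ drift e j + M
    odd-gap⇒drift≢+m {i} {j} s i≡ i<n Di≡Dj+M =
      ℕP.m≢1+n+m j (trans (sym (injective i<n (smaller _ i≡ i<n) i≈j)) i≡)
      where
      open ≡-Reasoning
      cancel : ∀ S M x → (+ 1 + + 2 * S) * M + (x + M) - x ≡ (+ 1 + S) * (M + M)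
      cancel = solve-∀
      i≈j : position e i ≈ position e j
      i≈j = positions-≈ e (suc (2 ℕ.* s)) (+ 1 + + s) i≡ (begin
        + suc (2 ℕ.* s) * M + drift e i - drift e j
          ≡⟨ cong₂ (λ x y → x * M + y - drift e j) (+1+2s s) Di≡Dj+M ⟩
        (+ 1 + + 2 * + s) * M + (drift e j + M) - drift e j ≡⟨ cancel (+ s) M (drift e j) ⟩
        (+ 1 + + s) * N                                     ∎)

    no-cancel₂ : ∀ {i s} → 2 ℕ.+ i < n → e i ≡ s → e (suc i) ≢ neg s
    no-cancel₂ {i} lt refl eq = even-gap⇒drift≢ 0 refl lt (begin
      drift e i + ⟦ e i ⟧ + ⟦ e (suc i) ⟧      ≡⟨ cong (λ s → drift e i + ⟦ e i ⟧ + ⟦ s ⟧) eq ⟩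
      drift e i + ⟦ e i ⟧ + ⟦ neg (e i) ⟧      ≡⟨ cong (λ x → drift e i + ⟦ e i ⟧ + x) (⟦neg⟧ (e i)) ⟩
      drift e i + ⟦ e i ⟧ + - ⟦ e i ⟧          ≡⟨ cancel (drift e i) ⟦ e i ⟧ ⟩
      drift e i                                ∎)
      where
      open ≡-Reasoning
      cancel : ∀ x a → x + a + - a ≡ x
      cancel = solve-∀

    no-cancel₄ : ∀ {i a b c d} → 4 ℕ.+ i < n → e i ≡ a → e (1 ℕ.+ i) ≡ b → e (2 ℕ.+ i) ≡ c →
                 ⟦ a ⟧ + ⟦ b ⟧ + ⟦ c ⟧ + ⟦ d ⟧ ≡ + 0 → e (3 ℕ.+ i) ≢ d
    no-cancel₄ {i} {a} {b} {c} {d} lt refl refl refl sum≡0 refl = even-gap⇒drift≢ 1 refl lt (begin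
      drift e i + ⟦ a ⟧ + ⟦ b ⟧ + ⟦ c ⟧ + ⟦ d ⟧    ≡⟨ regroup (drift e i) ⟦ a ⟧ ⟦ b ⟧ ⟦ c ⟧ ⟦ d ⟧ ⟩
      drift e i + (⟦ a ⟧ + ⟦ b ⟧ + ⟦ c ⟧ + ⟦ d ⟧)  ≡⟨ cong (λ x → drift e i + x) sum≡0 ⟩
      drift e i + + 0                              ≡⟨ ℤP.+-identityʳ (drift e i) ⟩
      drift e i                                    ∎)
      where
      open ≡-Reasoning
      regroup : ∀ x a b c d → x + a + b + c + d ≡ x + (a + b + c + d)
      regroup = solve-∀

    private
      -- From position 3 on the drift stays in [2, m]: reaching 1 or m + 1 would repeat
      -- the symbol at position 1 or 2.  By parity s₁ + m then needs an even position
      -- with drift m, and the neighbouring positions rule that out.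
      module UpFlatUp (e₀ : e 0 ≡ up) (e₁ : e 1 ≡ flat) (e₂ : e 2 ≡ up) where

        drift₁ : drift e 1 ≡ + 1
        drift₁ = drift-step e e₀

        drift₂ : drift e 2 ≡ + 1
        drift₂ = trans (drift-step e e₁) (cong (_+ + 0) drift₁)

        drift₃ : drift e 3 ≡ + 2
        drift₃ = trans (drift-step e e₂) (cong (_+ + 1) drift₂)

        never-one : ∀ d → 3 ℕ.+ d < n → drift e (3 ℕ.+ d) ≢ + 1
        never-one d lt D≡1 with even-or-odd d
        ... | s , inj₁ refl = even-gap⇒drift≢ s (index s) lt (trans D≡1 (sym drift₁))
          where
          index : ∀ s → 3 ℕ.+ 2 ℕ.* s ≡ 2 ℕ.* suc s ℕ.+ 1
          index = ℕSolver.solve-∀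
        ... | s , inj₂ refl = even-gap⇒drift≢ s (index s) lt (trans D≡1 (sym drift₂))
          where
          index : ∀ s → 3 ℕ.+ suc (2 ℕ.* s) ≡ 2 ℕ.* suc s ℕ.+ 2
          index = ℕSolver.solve-∀

        never-m+1 : ∀ d → 3 ℕ.+ d < n → drift e (3 ℕ.+ d) ≢ M + + 1
        never-m+1 d lt D≡M+1 with even-or-odd d
        ... | s , inj₁ refl = odd-gap⇒drift≢+m {j = 2} s (index s) lt
                (trans D≡M+1 (trans (ℤP.+-comm M (+ 1)) (cong (_+ M) (sym drift₂))))
          where
          index : ∀ s → 3 ℕ.+ 2 ℕ.* s ≡ suc (2 ℕ.* s) ℕ.+ 2
          index = ℕSolver.solve-∀
        ... | s , inj₂ refl = odd-gap⇒drift≢+m {j = 1} (suc s) (index s) lt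
                (trans D≡M+1 (trans (ℤP.+-comm M (+ 1)) (cong (_+ M) (sym drift₁))))
          where
          index : ∀ s → 3 ℕ.+ suc (2 ℕ.* s) ≡ suc (2 ℕ.* suc s) ℕ.+ 1
          index = ℕSolver.solve-∀

        Bounded : ℕ → Set
        Bounded i = ∃ λ u → drift e i ≡ + u × 2 ≤ u × u ≤ m

        bounded : ∀ d → 3 ℕ.+ d < n → Bounded (3 ℕ.+ d)
        bounded zero    _  = 2 , drift₃ , ℕP.≤-refl , s≤s (s≤s z≤n)
        bounded (suc d) lt = extend (bounded d (ℕP.<⇒≤ lt)) refl
          where
          extend : ∀ {s} → Bounded (3 ℕ.+ d) → e (3 ℕ.+ d) ≡ s → Bounded (4 ℕ.+ d)
          extend {flat} (u , D≡u , 2≤u , u≤m) eq =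
            u , trans (drift-step e eq) (trans (cong (_+ + 0) D≡u) (ℤP.+-identityʳ (+ u))) , 2≤u , u≤m
          extend {up} (u , D≡u , 2≤u , u≤m) eq with ℕP.m≤n⇒m<n∨m≡n u≤m
          ... | inj₁ u<m = suc u , trans (drift-step e eq) (trans (cong (_+ + 1) D≡u) (cong +_ (ℕP.+-comm u 1))) ,
                           ℕP.m≤n⇒m≤1+n 2≤u , u<m
          ... | inj₂ refl = ⊥-elim (never-m+1 (suc d) lt (trans (drift-step e eq) (cong (_+ + 1) D≡u)))
          extend {down} (suc zero , _ , s≤s () , _) _
          extend {down} (suc (suc zero) , D≡u , _ , _) eq =
            ⊥-elim (never-one (suc d) lt (trans (drift-step e eq) (cong (_+ -[1+ 0 ]) D≡u)))
          extend {down} (suc (suc (suc u)) , D≡u , _ , u≤m) eq =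
            suc (suc u) , trans (drift-step e eq) (cong (_+ -[1+ 0 ]) D≡u) , s≤s (s≤s z≤n) , ℕP.m≤n⇒m≤1+n (ℕP.≤-pred u≤m)

        drift≢m : ∀ s → 4 ℕ.+ 2 ℕ.* s < n → drift e (4 ℕ.+ 2 ℕ.* s) ≢ M
        drift≢m s lt D≡M = from-below refl
          where
          next<n : 5 ℕ.+ 2 ℕ.* s < n
          next<n = subst (_< n) (sym (index s)) (2a<n⇒1+2a<n (2 ℕ.+ s) (subst (_< n) (index′ s) lt))
            where
            index : ∀ s → 5 ℕ.+ 2 ℕ.* s ≡ suc (2 ℕ.* (2 ℕ.+ s))
            index = ℕSolver.solve-∀
            index′ : ∀ s → 4 ℕ.+ 2 ℕ.* s ≡ 2 ℕ.* (2 ℕ.+ s)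
            index′ = ℕSolver.solve-∀

          odd-index : ∀ s → 3 ℕ.+ 2 ℕ.* s ≡ suc (2 ℕ.* suc s) ℕ.+ 0
          odd-index = ℕSolver.solve-∀
          odd-index′ : ∀ s → 5 ℕ.+ 2 ℕ.* s ≡ suc (2 ℕ.* suc (suc s)) ℕ.+ 0
          odd-index′ = ℕSolver.solve-∀

          from-below : ∀ {a} → e (3 ℕ.+ 2 ℕ.* s) ≡ a → ⊥
          from-below {down} eq = never-m+1 (2 ℕ.* s) (ℕP.<⇒≤ lt) (drift-before e eq D≡M)
          from-below {flat} eq = odd-gap⇒drift≢+m {j = 0} (suc s) (odd-index s) (ℕP.<⇒≤ lt)
                                   (trans (drift-before e eq D≡M) (ℤP.+-identityʳ M))
          from-below {up}   eq = to-above refl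
            where
            to-above : ∀ {b} → e (4 ℕ.+ 2 ℕ.* s) ≡ b → ⊥
            to-above {up}   eq′ = never-m+1 (suc (suc (2 ℕ.* s))) next<n
                                    (trans (drift-step e eq′) (cong (_+ + 1) D≡M))
            to-above {flat} eq′ = odd-gap⇒drift≢+m {j = 0} (suc (suc s)) (odd-index′ s) next<n
                                    (trans (drift-step e eq′) (trans (cong (_+ + 0) D≡M) (ℤP.+-identityʳ M)))
            to-above {down} eq′ = even-gap⇒drift≢ 0 refl next<n
                                    (trans (drift-step e eq′) (trans (cong (_+ -[1+ 0 ]) D≡M) (sym (drift-before e eq D≡M))))

        impossible : ⊥
        impossible with covers {0} 0<n
        ... | zero , _ , P≈M = ℕP.0≢1+n (residue-unique 0<n m<n P≈M)
        ... | suc zero , _ , P≈M = ℕP.m+1+n≢m m (residue-unique m+1<n m<n (≈-trans (≈-sym P≈M+1) P≈M))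
          where
          m+1<n : m ℕ.+ 1 < n
          m+1<n = ℕP.+-monoʳ-< m (s≤s (s≤s z≤n))
          P≈M+1 : position e 1 ≈ M + + 1
          P≈M+1 = ≈-trans (odd-position e 0 refl) (≈-reflexive (cong (_+_ M) drift₁))
        ... | suc (suc zero) , _ , P≈M = ℕP.0≢1+n (ℕP.suc-injective (residue-unique (s≤s (s≤s z≤n)) m<n (≈-trans (≈-sym P≈1) P≈M)))
          where
          P≈1 : position e 2 ≈ + 1
          P≈1 = ≈-trans (even-position e 1 refl) (≈-reflexive drift₂)
        ... | suc (suc (suc d)) , i<n , P≈M with bounded d i<n | even-or-odd d
        ...   | u , D≡u , 2≤u , u≤m | s , inj₁ refl = ℕP.<⇒≢ (ℕP.<-trans (s≤s z≤n) 2≤u) (sym u≡0)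
          where
          index : ∀ s → 3 ℕ.+ 2 ℕ.* s ≡ suc (2 ℕ.* suc s)
          index = ℕSolver.solve-∀
          u≡0 : u ≡ 0
          u≡0 = residue-unique (ℕP.≤-<-trans u≤m m<n) 0<n (≈-cancelˡ M (≈-trans (≈-sym
                  (≈-trans (odd-position e (suc s) (index s)) (≈-reflexive (cong (_+_ M) D≡u))))
                  (≈-trans P≈M (≈-reflexive (sym (ℤP.+-identityʳ M))))))
        ...   | u , D≡u , 2≤u , u≤m | s , inj₂ refl = drift≢m s i<n (trans D≡u (cong +_ u≡m))
          where
          index : ∀ s → 3 ℕ.+ suc (2 ℕ.* s) ≡ 2 ℕ.* (2 ℕ.+ s)
          index = ℕSolver.solve-∀
          u≡m : u ≡ m
          u≡m = residue-unique (ℕP.≤-<-trans u≤m m<n) m<n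
                  (≈-trans (≈-sym (≈-trans (even-position e (2 ℕ.+ s) (index s)) (≈-reflexive D≡u))) P≈M)

    no-up-flat-up : e 0 ≡ up → e 1 ≡ flat → e 2 ≡ up → ⊥
    no-up-flat-up = UpFlatUp.impossible

  -- Negated and reversed rows

  negate-row : ∀ {e} → IsRow e → IsRow (neg ∘ e)
  negate-row {e} R = record { injective = injective′ ; covers = covers′ }
    where
    open IsRow R

    drift-neg : ∀ i → drift (neg ∘ e) i ≡ - drift e i
    drift-neg zero    = refl
    drift-neg (suc i) = begin
      drift (neg ∘ e) i + ⟦ neg (e i) ⟧ ≡⟨ cong₂ _+_ (drift-neg i) (⟦neg⟧ (e i)) ⟩
      - drift e i + - ⟦ e i ⟧          ≡⟨ sym (ℤP.neg-distrib-+ (drift e i) ⟦ e i ⟧) ⟩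
      - (drift e i + ⟦ e i ⟧)          ∎
      where open ≡-Reasoning

    position-neg : ∀ i → position (neg ∘ e) i ≈ - position e i
    position-neg i = mod-n (divides (+ i) (begin
      + i * M + drift (neg ∘ e) i - - (+ i * M + drift e i) ≡⟨ cong (λ x → + i * M + x - - position e i) (drift-neg i) ⟩
      + i * M + - drift e i - - (+ i * M + drift e i)       ≡⟨ cancel (+ i) M (drift e i) ⟩
      + i * N                                               ∎))
      where
      open ≡-Reasoning
      cancel : ∀ I M x → I * M + - x - - (I * M + x) ≡ I * (M + M)
      cancel = solve-∀

    unnegate : ∀ {a b} → - a ≈ - b → a ≈ b
    unnegate {a} {b} -a≈-b = subst₂ _≈_ (ℤP.neg-involutive a) (ℤP.neg-involutive b) (≈-neg -a≈-b)

    injective′ : ∀ {i j} → i < n → j < n → position (neg ∘ e) i ≈ position (neg ∘ e) j → i ≡ j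
    injective′ {i} {j} i<n j<n i≈j = injective i<n j<n
      (unnegate (≈-trans (≈-sym (position-neg i)) (≈-trans i≈j (position-neg j))))


    covers′ : ∀ {p} → p < n → ∃ λ i → i < n × position (neg ∘ e) i ≈ position (neg ∘ e) p + M
    covers′ {p} p<n with covers p<n
    ... | i , i<n , i≈p+M = i , i<n , (begin
      position (neg ∘ e) i         ≈⟨ position-neg i ⟩
      - position e i               ≈⟨ ≈-neg i≈p+M ⟩
      - (position e p + M)         ≡⟨ ℤP.neg-distrib-+ (position e p) M ⟩
      - position e p + - M         ≈⟨ ≈-+ (≈-sym (position-neg p)) -M≈M ⟩
      position (neg ∘ e) p + M     ∎)
      where open ≈-Reasoning

  mirror : ℕ → ℕ
  mirror i = n ∸ 1 ∸ i

  mirror<n : ∀ i → mirror i < n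
  mirror<n i = ℕP.≤-<-trans (ℕP.m∸n≤m (n ∸ 1) i) (ℕP.n<1+n (n ∸ 1))

  mirror-involutive : ∀ {i} → i < n → mirror (mirror i) ≡ i
  mirror-involutive i<n = ℕP.m∸[m∸n]≡n (ℕP.≤-pred i<n)

  mirror-injective : ∀ {i j} → i < n → j < n → mirror i ≡ mirror j → i ≡ j
  mirror-injective i<n j<n = ℕP.∸-cancelˡ-≡ (ℕP.≤-pred i<n) (ℕP.≤-pred j<n)

  mirror-suc : ∀ {i} → suc i < n → mirror i ≡ suc (mirror (suc i))
  mirror-suc lt = ℕP.+-∸-assoc 1 (ℕP.≤-pred (ℕP.≤-pred lt))

  reverse : (ℕ → Step) → ℕ → Step
  reverse e i = e (mirror (suc i))

  reverse-row : ∀ {e} → IsRow e → IsRow (reverse e)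
  reverse-row {e} R = record { injective = injective′ ; covers = covers′ }
    where
    open IsRow R

    drift-reverse : ∀ i → i < n → drift (reverse e) i ≡ drift e (n ∸ 1) - drift e (mirror i)
    drift-reverse zero    _  = sym (ℤP.+-inverseʳ (drift e (n ∸ 1)))
    drift-reverse (suc i) lt = begin
      drift (reverse e) i + ⟦ e x ⟧                            ≡⟨ cong (_+ ⟦ e x ⟧) (drift-reverse i (ℕP.<⇒≤ lt)) ⟩
      drift e (n ∸ 1) - drift e (mirror i) + ⟦ e x ⟧         ≡⟨ cong (λ j → drift e (n ∸ 1) - drift e j + ⟦ e x ⟧) (mirror-suc lt) ⟩
      drift e (n ∸ 1) - (drift e x + ⟦ e x ⟧) + ⟦ e x ⟧      ≡⟨ cancel (drift e (n ∸ 1)) (drift e x) ⟦ e x ⟧ ⟩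
      drift e (n ∸ 1) - drift e x                            ∎
      where
      open ≡-Reasoning
      x : ℕ
      x = mirror (suc i)
      cancel : ∀ a b c → a - (b + c) + c ≡ a - b
      cancel = solve-∀

    position-reverse : ∀ i → i < n → position (reverse e) i ≡ position e (n ∸ 1) - position e (mirror i)
    position-reverse i i<n = begin
      + i * M + drift (reverse e) i                                           ≡⟨ cong (λ x → + i * M + x) (drift-reverse i i<n) ⟩
      + i * M + (drift e (n ∸ 1) - drift e (mirror i))                     ≡⟨ regroup (+ i) (+ mirror i) M (drift e (n ∸ 1)) (drift e (mirror i)) ⟩
      (+ i + + mirror i) * M + drift e (n ∸ 1) - (+ mirror i * M + drift e (mirror i))
        ≡⟨ cong (λ j → j * M + drift e (n ∸ 1) - position e (mirror i)) (trans (sym (ℤP.pos-+ i (mirror i))) (cong +_ (ℕP.m+[n∸m]≡n (ℕP.≤-pred i<n)))) ⟩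
      position e (n ∸ 1) - position e (mirror i)                           ∎
      where
      open ≡-Reasoning
      regroup : ∀ I J M a b → I * M + (a - b) ≡ (I + J) * M + a - (J * M + b)
      regroup = solve-∀

    injective′ : ∀ {i j} → i < n → j < n → position (reverse e) i ≈ position (reverse e) j → i ≡ j
    injective′ {i} {j} i<n j<n i≈j = mirror-injective i<n j<n (injective (mirror<n i) (mirror<n j)
      (subst₂ _≈_ (ℤP.neg-involutive _) (ℤP.neg-involutive _) (≈-neg (≈-cancelˡ (position e (n ∸ 1))
        (subst₂ _≈_ (position-reverse i i<n) (position-reverse j j<n) i≈j)))))

    covers′ : ∀ {p} → p < n → ∃ λ i → i < n × position (reverse e) i ≈ position (reverse e) p + M
    covers′ {p} p<n with covers (mirror<n p)
    ... | i , i<n , i≈p+M = mirror i , mirror<n i , (begin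
      position (reverse e) (mirror i)                        ≡⟨ position-reverse (mirror i) (mirror<n i) ⟩
      last - position e (mirror (mirror i))                  ≡⟨ cong (λ j → last - position e j) (mirror-involutive i<n) ⟩
      last - position e i                                    ≈⟨ ≈-+ (≈-refl {last}) (≈-neg i≈p+M) ⟩
      last - (position e (mirror p) + M)                     ≡⟨ regroup last (position e (mirror p)) M ⟩
      last - position e (mirror p) + - M                     ≈⟨ ≈-+ (≈-refl {last - position e (mirror p)}) -M≈M ⟩
      last - position e (mirror p) + M                       ≡⟨ cong (_+ M) (sym (position-reverse p p<n)) ⟩
      position (reverse e) p + M                             ∎)
      where
      open ≈-Reasoning
      last : ℤ
      last = position e (n ∸ 1)
      regroup : ∀ a b c → a - (b + c) ≡ a - b + - c
      regroup = solve-∀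

  no-down-flat-down : ∀ {e} → IsRow e → e 0 ≡ down → e 1 ≡ flat → e 2 ≡ down → ⊥
  no-down-flat-down R e₀ e₁ e₂ = RowConstraints.no-up-flat-up (negate-row R) (cong neg e₀) (cong neg e₁) (cong neg e₂)

  -- Crossings

  -- c i encodes column i of a rectangle: the entry in the e-row exceeds the one in
  -- the e′-row by m + c i modulo n, and the recurrence compares the two ways around a square.
  record ColumnSteps (c e e′ : ℕ → Step) : Set where
    constructor column-steps
    field step : ∀ i → suc i < n → ColumnStep (c i) (c (suc i)) (e i) (e′ i)

  swap-column : ∀ {c e e′} → ColumnSteps c e e′ → ColumnSteps (neg ∘ c) e′ e
  swap-column {c} {e} {e′} (column-steps C) = column-steps λ i lt → begin
    ⟦ neg (c (suc i)) ⟧                   ≡⟨ ⟦neg⟧ (c (suc i)) ⟩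
    - ⟦ c (suc i) ⟧                       ≡⟨ cong -_ (C i lt) ⟩
    - (⟦ c i ⟧ + ⟦ e i ⟧ - ⟦ e′ i ⟧)      ≡⟨ regroup ⟦ c i ⟧ ⟦ e i ⟧ ⟦ e′ i ⟧ ⟩
    - ⟦ c i ⟧ + ⟦ e′ i ⟧ - ⟦ e i ⟧        ≡⟨ cong (λ x → x + ⟦ e′ i ⟧ - ⟦ e i ⟧) (sym (⟦neg⟧ (c i))) ⟩
    ⟦ neg (c i) ⟧ + ⟦ e′ i ⟧ - ⟦ e i ⟧    ∎
    where
    open ≡-Reasoning
    regroup : ∀ c a b → - (c + a - b) ≡ - c + b - a
    regroup = solve-∀

  reverse-column : ∀ {c e e′} → ColumnSteps c e e′ → ColumnSteps (neg ∘ c ∘ mirror) (reverse e) (reverse e′)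
  reverse-column {c} {e} {e′} (column-steps C) = column-steps step
    where
    open ≡-Reasoning
    regroup : ∀ c a b → - c ≡ - (c + a - b) + a - b
    regroup = solve-∀
    step : ∀ i → suc i < n → ColumnStep (neg (c (mirror i))) (neg (c (mirror (suc i)))) (reverse e i) (reverse e′ i)
    step i lt = begin
      ⟦ neg (c x) ⟧                                   ≡⟨ ⟦neg⟧ (c x) ⟩
      - ⟦ c x ⟧                                       ≡⟨ regroup ⟦ c x ⟧ ⟦ e x ⟧ ⟦ e′ x ⟧ ⟩
      - (⟦ c x ⟧ + ⟦ e x ⟧ - ⟦ e′ x ⟧) + ⟦ e x ⟧ - ⟦ e′ x ⟧
        ≡⟨ cong (λ y → - y + ⟦ e x ⟧ - ⟦ e′ x ⟧) (sym (C x (subst (_< n) (mirror-suc lt) (mirror<n i)))) ⟩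
      - ⟦ c (suc x) ⟧ + ⟦ e x ⟧ - ⟦ e′ x ⟧          ≡⟨ cong (λ j → - ⟦ c j ⟧ + ⟦ e x ⟧ - ⟦ e′ x ⟧) (sym (mirror-suc lt)) ⟩
      - ⟦ c (mirror i) ⟧ + ⟦ e x ⟧ - ⟦ e′ x ⟧       ≡⟨ cong (λ y → y + ⟦ e x ⟧ - ⟦ e′ x ⟧) (sym (⟦neg⟧ (c (mirror i)))) ⟩
      ⟦ neg (c (mirror i)) ⟧ + ⟦ e x ⟧ - ⟦ e′ x ⟧   ∎
      where
      x : ℕ
      x = mirror (suc i)

  module Crossing {e e′ c} (R : IsRow e) (R′ : IsRow e′) (C : ColumnSteps c e e′) where
    open RowConstraints R
    open ColumnSteps C
    module R′ = RowConstraints R′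

    column : ∀ {i a b} → suc i < n → e i ≡ a → e′ i ≡ b → ColumnStep (c i) (c (suc i)) a b
    column lt refl refl = step _ lt

    up-down-column : ∀ {j} → suc j < n → e j ≡ up → e′ j ≡ down → c j ≡ down × c (suc j) ≡ up
    up-down-column lt eⱼ e′ⱼ = column-up-down (column lt eⱼ e′ⱼ)

    flat-after : ∀ {j} → 2 ℕ.+ j < n → e j ≡ up → e′ j ≡ down → e (suc j) ≡ flat × e′ (suc j) ≡ flat
    flat-after {j} lt eⱼ e′ⱼ = column-after-up (no-cancel₂ lt eⱼ) (R′.no-cancel₂ lt e′ⱼ)
      (subst (λ x → ColumnStep x (c (2 ℕ.+ j)) (e (suc j)) (e′ (suc j)))
             (proj₂ (up-down-column (ℕP.<⇒≤ lt) eⱼ e′ⱼ)) (step (suc j) lt))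

    flat-before : ∀ {i} → 2 ℕ.+ i < n → e (suc i) ≡ up → e′ (suc i) ≡ down → e i ≡ flat × e′ i ≡ flat
    flat-before {i} lt eᵢ₊₁ e′ᵢ₊₁ = column-before-down {c i}
      (λ eᵢ≡down → no-cancel₂ lt eᵢ≡down eᵢ₊₁) (λ e′ᵢ≡up → R′.no-cancel₂ lt e′ᵢ≡up e′ᵢ₊₁)
      (subst (λ x → ColumnStep (c i) x (e i) (e′ i)) (proj₁ (up-down-column lt eᵢ₊₁ e′ᵢ₊₁)) (step i (ℕP.<⇒≤ lt)))

    start-crossing : e 0 ≡ up → e′ 0 ≡ down → ⊥
    start-crossing e₀ e′₀ = up≢down (trans (sym c₃≡up) c₃≡down)
      where
      e₁ : e 1 ≡ flat
      e₁ = proj₁ (flat-after (ℕP.<⇒≤ (ℕP.<⇒≤ 4<n)) e₀ e′₀)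
      e′₁ : e′ 1 ≡ flat
      e′₁ = proj₂ (flat-after (ℕP.<⇒≤ (ℕP.<⇒≤ 4<n)) e₀ e′₀)
      e₂ : e 2 ≡ down
      e₂ = ≢flat,up⇒down (no-cancel₂ (ℕP.<⇒≤ 4<n) e₁) (no-up-flat-up e₀ e₁)
      e′₂ : e′ 2 ≡ up
      e′₂ = ≢flat,down⇒up (R′.no-cancel₂ (ℕP.<⇒≤ 4<n) e′₁) (no-down-flat-down R′ e′₀ e′₁)
      e₃ : e 3 ≡ down
      e₃ = ≢flat,up⇒down (no-cancel₄ 4<n e₀ e₁ e₂ refl) (no-cancel₂ 4<n e₂)
      e′₃ : e′ 3 ≡ up
      e′₃ = ≢flat,down⇒up (R′.no-cancel₄ 4<n e′₀ e′₁ e′₂ refl) (R′.no-cancel₂ 4<n e′₂)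
      c₃≡down : c 3 ≡ down
      c₃≡down = proj₂ (column-down-up {c 2} (column (ℕP.<⇒≤ 4<n) e₂ e′₂))
      c₃≡up : c 3 ≡ up
      c₃≡up = proj₁ (column-down-up (column 4<n e₃ e′₃))

    -- The flat steps around a crossing at j force a crossing at j + 2, which needs
    -- c (j + 2) ≡ down although the flat steps keep the column at up.
    inner-crossing : ∀ {i} → 4 ℕ.+ i < n → e (suc i) ≡ up → e′ (suc i) ≡ down → ⊥
    inner-crossing {i} lt eⱼ e′ⱼ = up≢down (trans (sym c₊₂≡up) c₊₂≡down)
      where
      2+i<n : 2 ℕ.+ i < n
      2+i<n = ℕP.<⇒≤ (ℕP.<⇒≤ lt)
      3+i<n : 3 ℕ.+ i < n
      3+i<n = ℕP.<⇒≤ lt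
      eᵢ : e i ≡ flat
      eᵢ = proj₁ (flat-before 2+i<n eⱼ e′ⱼ)
      e′ᵢ : e′ i ≡ flat
      e′ᵢ = proj₂ (flat-before 2+i<n eⱼ e′ⱼ)
      e₊₁ : e (2 ℕ.+ i) ≡ flat
      e₊₁ = proj₁ (flat-after 3+i<n eⱼ e′ⱼ)
      e′₊₁ : e′ (2 ℕ.+ i) ≡ flat
      e′₊₁ = proj₂ (flat-after 3+i<n eⱼ e′ⱼ)
      c₊₂≡up : c (3 ℕ.+ i) ≡ up
      c₊₂≡up = trans (column-flat (column 3+i<n e₊₁ e′₊₁)) (proj₂ (up-down-column 2+i<n eⱼ e′ⱼ))
      e₊₂ : e (3 ℕ.+ i) ≡ up
      e₊₂ = ≢flat,down⇒up (no-cancel₂ lt e₊₁) (no-cancel₄ lt eᵢ eⱼ e₊₁ refl)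
      e′₊₂ : e′ (3 ℕ.+ i) ≡ down
      e′₊₂ = ≢flat,up⇒down (R′.no-cancel₂ lt e′₊₁) (R′.no-cancel₄ lt e′ᵢ e′ⱼ e′₊₁ refl)
      c₊₂≡down : c (3 ℕ.+ i) ≡ down
      c₊₂≡down = proj₁ (up-down-column lt e₊₂ e′₊₂)

    crossing-forward : ∀ j → 3 ℕ.+ j < n → e j ≡ up → e′ j ≡ down → ⊥
    crossing-forward zero    _  = start-crossing
    crossing-forward (suc i) lt = inner-crossing lt

  mirror-of-late : ∀ {j} → suc j < n → ¬ (3 ℕ.+ j < n) → 3 ℕ.+ mirror (suc j) < n
  mirror-of-late {j} lt late = begin
    4 ℕ.+ mirror (suc j)        ≤⟨ ℕP.+-monoˡ-≤ (mirror (suc j)) 4≤1+j ⟩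
    suc j ℕ.+ mirror (suc j)    ≡⟨ cong suc (ℕP.m+[n∸m]≡n (ℕP.≤-pred (ℕP.≤-pred lt))) ⟩
    suc (n ∸ 2)               ≤⟨ ℕP.n≤1+n (suc (n ∸ 2)) ⟩
    n                           ∎
    where
    open ℕP.≤-Reasoning
    4≤1+j : 4 ≤ suc j
    4≤1+j = s≤s (ℕP.+-cancelˡ-≤ 3 3 j (ℕP.≤-trans six≤n (ℕP.≮⇒≥ late)))

  -- A crossing near the end of the rows is one near the start of the reversed rectangle.
  no-up-down-crossing : ∀ {c e e′} → IsRow e → IsRow e′ → ColumnSteps c e e′ →
                        ∀ {j} → suc j < n → e j ≡ up → e′ j ≡ down → ⊥
  no-up-down-crossing {e = e} {e′} R R′ C {j} lt eⱼ e′ⱼ with 3 ℕ.+ j ℕ.<? n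
  ... | yes early = Crossing.crossing-forward R R′ C j early eⱼ e′ⱼ
  ... | no  late  = Crossing.crossing-forward (reverse-row R) (reverse-row R′) (reverse-column C)
                      (mirror (suc j)) (mirror-of-late lt late) (trans (cong e back) eⱼ) (trans (cong e′ back) e′ⱼ)
    where
    back : mirror (suc (mirror (suc j))) ≡ j
    back = trans (cong mirror (sym (mirror-suc lt))) (mirror-involutive (ℕP.<⇒≤ lt))

  no-down-up-crossing : ∀ {c e e′} → IsRow e → IsRow e′ → ColumnSteps c e e′ →
                        ∀ {j} → suc j < n → e j ≡ down → e′ j ≡ up → ⊥
  no-down-up-crossing R R′ C lt eⱼ e′ⱼ = no-up-down-crossing R′ R (swap-column C) lt e′ⱼ eⱼ

  -- Latin rectangles

  at : Row n → ℕ → ℕ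
  at t i with i ℕ.<? n
  ... | yes i<n = t (fromℕ< i<n)
  ... | no  _   = 0

  at-fromℕ< : ∀ t {i} (i<n : i < n) → at t i ≡ t (fromℕ< i<n)
  at-fromℕ< t {i} i<n with i ℕ.<? n
  ... | yes _   = refl
  ... | no  i≮n = ⊥-elim (i≮n i<n)

  at-toℕ : ∀ t (x : Fin n) → at t (toℕ x) ≡ t x
  at-toℕ t x = trans (at-fromℕ< t (FP.toℕ<n x)) (cong t (FP.fromℕ<-toℕ x (FP.toℕ<n x)))

  classify : ℕ → Step
  classify h with ℕP.<-cmp h m
  ... | tri< _ _ _ = down
  ... | tri≈ _ _ _ = flat
  ... | tri> _ _ _ = up

  classify-near : ∀ {h} → m ∸ 1 ≤ h → h ≤ suc m → + h ≡ M + ⟦ classify h ⟧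
  classify-near {h} lo hi with ℕP.<-cmp h m
  ... | tri< h<m _ _ rewrite ℕP.≤-antisym (ℕP.≤-pred h<m) lo = refl
  ... | tri≈ _ refl _ = sym (ℤP.+-identityʳ M)
  ... | tri> _ _ m<h rewrite ℕP.≤-antisym hi m<h = cong +_ (ℕP.+-comm 1 m)

  hDiff-≈ : ∀ a b → + a + + hDiff n a b ≈ + b
  hDiff-≈ a b = begin
    + a + + hDiff n a b   ≈⟨ ≈-+ (≈-refl {+ a}) (%ℕ-≈ (+ b - + a)) ⟩
    + a + (+ b - + a)     ≡⟨ cancel (+ a) (+ b) ⟩
    + b                   ∎
    where
    open ≈-Reasoning
    cancel : ∀ a b → a + (b - a) ≡ b
    cancel = solve-∀

  far⇒near : ∀ {a b} → Far n a b → m ∸ 1 ≤ hDiff n a b × hDiff n a b ≤ suc m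
  far⇒near {a} {b} far = near (hDiff n a b) refl
    where
    far′ : m ∸ 1 ≤ ((+ a - + b) %ℕ n) ⊓ hDiff n a b
    far′ = subst (λ x → x ∸ 1 ≤ dist n a b) (sym (ℕP.n≡⌊n+n/2⌋ m)) far
    near : ∀ h → hDiff n a b ≡ h → m ∸ 1 ≤ h × h ≤ suc m
    near zero    h≡0 = ⊥-elim (ℕP.<⇒≱ (s≤s z≤n) (subst (m ∸ 1 ≤_) h≡0 (ℕP.m≤n⊓o⇒m≤o _ _ far′)))
    near (suc h) h≡  = lo , hi
      where
      h<n : suc h < n
      h<n = subst (_< n) h≡ (ℤDM.n%ℕd<d (+ b - + a) n)
      opposite : (+ a - + b) %ℕ n ≡ n ∸ suc h
      opposite = residue-unique (ℤDM.n%ℕd<d (+ a - + b) n) (ℕP.∸-monoʳ-< (s≤s z≤n) (ℕP.<⇒≤ h<n)) (begin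
        + ((+ a - + b) %ℕ n)   ≈⟨ %ℕ-≈ (+ a - + b) ⟩
        + a - + b              ≡⟨ regroup (+ a) (+ b) ⟩
        - (+ b - + a)          ≈⟨ ≈-neg (≈-sym (%ℕ-≈ (+ b - + a))) ⟩
        - + hDiff n a b        ≡⟨ cong (λ y → - + y) h≡ ⟩
        - + suc h              ≈⟨ complement-≈ (ℕP.<⇒≤ h<n) ⟩
        + (n ∸ suc h)          ∎)
        where
        open ≈-Reasoning
        regroup : ∀ a b → a - b ≡ - (b - a)
        regroup = solve-∀
      lo : m ∸ 1 ≤ suc h
      lo = subst (m ∸ 1 ≤_) h≡ (ℕP.m≤n⊓o⇒m≤o _ _ far′)
      hi : suc h ≤ suc m
      hi = ℕP.+-cancelʳ-≤ (m ∸ 1) (suc h) (suc m) (begin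
        suc h ℕ.+ (m ∸ 1)          ≤⟨ ℕP.+-monoʳ-≤ (suc h) (subst (m ∸ 1 ≤_) opposite (ℕP.m≤n⊓o⇒m≤n _ _ far′)) ⟩
        suc h ℕ.+ (n ∸ suc h)      ≡⟨ ℕP.m+[n∸m]≡n (ℕP.<⇒≤ h<n) ⟩
        n                          ≡⟨ ℕP.+-suc m (m ∸ 1) ⟩
        suc m ℕ.+ (m ∸ 1)          ∎)
        where open ℕP.≤-Reasoning

  far-step : ∀ {a b} → Far n a b → + b ≈ + a + (M + ⟦ classify (hDiff n a b) ⟧)
  far-step {a} {b} far = ≈-trans (≈-sym (hDiff-≈ a b)) (≈-reflexive (cong (λ x → + a + x) (classify-near lo hi)))
    where
    lo : m ∸ 1 ≤ hDiff n a b
    lo = proj₁ (far⇒near {a} {b} far)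
    hi : hDiff n a b ≤ suc m
    hi = proj₂ (far⇒near {a} {b} far)

  steps : Row n → ℕ → Step
  steps t i = classify (hDiff n (at t i) (at t (suc i)))

  adjacent-far : ∀ {t} → MaxInnerDist n t → ∀ {i} → suc i < n → Far n (at t i) (at t (suc i))
  adjacent-far {t} far {i} lt =
    subst₂ (Far n) (sym (at-fromℕ< t i<n)) (sym (at-fromℕ< t lt)) (far (fromℕ< i<n) (fromℕ< lt) adjacent)
    where
    i<n : i < n
    i<n = ℕP.<⇒≤ lt
    adjacent : Adj (fromℕ< i<n) (fromℕ< lt)
    adjacent = trans (FP.toℕ-fromℕ< lt) (cong suc (sym (FP.toℕ-fromℕ< i<n)))

  position-suc : ∀ e i → position e (suc i) ≡ position e i + (M + ⟦ e i ⟧)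
  position-suc e i = regroup (+ i) M (drift e i) ⟦ e i ⟧
    where
    regroup : ∀ I M x a → (+ 1 + I) * M + (x + a) ≡ I * M + x + (M + a)
    regroup = solve-∀

  position-lift : ∀ {t} → MaxInnerDist n t → ∀ {i} → i < n → + at t i ≈ + at t 0 + position (steps t) i
  position-lift far {zero}      _  = ≈-reflexive (sym (ℤP.+-identityʳ _))
  position-lift {t} far {suc i} lt = begin
    + at t (suc i)                                         ≈⟨ far-step (adjacent-far {t} far lt) ⟩
    + at t i + (M + ⟦ steps t i ⟧)                         ≈⟨ ≈-+ (position-lift far (ℕP.<⇒≤ lt)) (≈-refl {M + ⟦ steps t i ⟧}) ⟩
    + at t 0 + position (steps t) i + (M + ⟦ steps t i ⟧)  ≡⟨ ℤP.+-assoc (+ at t 0) (position (steps t) i) (M + ⟦ steps t i ⟧) ⟩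
    + at t 0 + (position (steps t) i + (M + ⟦ steps t i ⟧)) ≡⟨ cong (λ x → + at t 0 + x) (sym (position-suc (steps t) i)) ⟩
    + at t 0 + position (steps t) (suc i)                  ∎
    where open ≈-Reasoning

  values-unique : ∀ {a b} → 1 ≤ a → a ≤ n → 1 ≤ b → b ≤ n → + a ≈ + b → a ≡ b
  values-unique {suc a} {suc b} _ a<n _ b<n a≈b = cong suc (residue-unique a<n b<n (≈-cancelˡ (+ 1) a≈b))

  latin⇒IsRow : ∀ {t} → LatinRow n t → MaxInnerDist n t → IsRow (steps t)
  latin⇒IsRow {t} (range , injective , surjective) far = record { injective = injective′ ; covers = covers′ }
    where
    range-at : ∀ {i} → i < n → 1 ≤ at t i × at t i ≤ n
    range-at i<n = subst (λ v → 1 ≤ v × v ≤ n) (sym (at-fromℕ< t i<n)) (range (fromℕ< i<n))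

    injective′ : ∀ {i j} → i < n → j < n → position (steps t) i ≈ position (steps t) j → i ≡ j
    injective′ {i} {j} i<n j<n i≈j = trans (sym (FP.toℕ-fromℕ< i<n)) (trans (cong toℕ same) (FP.toℕ-fromℕ< j<n))
      where
      values : at t i ≡ at t j
      values = values-unique (proj₁ (range-at i<n)) (proj₂ (range-at i<n)) (proj₁ (range-at j<n)) (proj₂ (range-at j<n))
        (begin
          + at t i                         ≈⟨ position-lift far i<n ⟩
          + at t 0 + position (steps t) i  ≈⟨ ≈-+ (≈-refl {+ at t 0}) i≈j ⟩
          + at t 0 + position (steps t) j  ≈⟨ ≈-sym (position-lift far j<n) ⟩
          + at t j                         ∎)
        where open ≈-Reasoning
      same : fromℕ< i<n ≡ fromℕ< j<n
      same = injective _ _ (trans (sym (at-fromℕ< t i<n)) (trans values (at-fromℕ< t j<n)))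

    shifted : ℕ → ℕ
    shifted p = (+ at t p + M - + 1) %ℕ n

    covers′ : ∀ {p} → p < n → ∃ λ i → i < n × position (steps t) i ≈ position (steps t) p + M
    covers′ {p} p<n with surjective (suc (shifted p)) (s≤s z≤n) (ℤDM.n%ℕd<d (+ at t p + M - + 1) n)
    ... | x , tx≡ = toℕ x , FP.toℕ<n x , ≈-cancelˡ (+ at t 0) (begin
      + at t 0 + position (steps t) (toℕ x)    ≈⟨ ≈-sym (position-lift far (FP.toℕ<n x)) ⟩
      + at t (toℕ x)                           ≡⟨ cong +_ (trans (at-toℕ t x) tx≡) ⟩
      + 1 + + shifted p                        ≈⟨ ≈-+ (≈-refl {+ 1}) (%ℕ-≈ (+ at t p + M - + 1)) ⟩
      + 1 + (+ at t p + M - + 1)               ≡⟨ cancel (+ at t p) M ⟩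
      + at t p + M                             ≈⟨ ≈-+ (position-lift far p<n) (≈-refl {M}) ⟩
      + at t 0 + position (steps t) p + M      ≡⟨ ℤP.+-assoc (+ at t 0) (position (steps t) p) M ⟩
      + at t 0 + (position (steps t) p + M)    ∎)
      where
      open ≈-Reasoning
      cancel : ∀ a M → + 1 + (a + M - + 1) ≡ a + M
      cancel = solve-∀

  column-class : Row n → Row n → ℕ → Step
  column-class t t′ i = classify (hDiff n (at t i) (at t′ i))

  exact-column-step : ∀ {c c′ a b} → ⟦ c′ ⟧ ≈ ⟦ c ⟧ + ⟦ a ⟧ - ⟦ b ⟧ → ColumnStep c c′ a b
  exact-column-step {c} {c′} {a} {b} (mod-n N∣) = ℤP.i-j≡0⇒i≡j _ _ (N∣x⇒x≡0 bound N∣)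
    where
    open ℕP.≤-Reasoning
    bound : ∣ ⟦ c′ ⟧ - (⟦ c ⟧ + ⟦ a ⟧ - ⟦ b ⟧) ∣ < n
    bound = begin-strict
      ∣ ⟦ c′ ⟧ - (⟦ c ⟧ + ⟦ a ⟧ - ⟦ b ⟧) ∣                  ≤⟨ ℤP.∣i-j∣≤∣i∣+∣j∣ ⟦ c′ ⟧ _ ⟩
      ∣ ⟦ c′ ⟧ ∣ ℕ.+ ∣ ⟦ c ⟧ + ⟦ a ⟧ - ⟦ b ⟧ ∣              ≤⟨ ℕP.+-monoʳ-≤ ∣ ⟦ c′ ⟧ ∣ (ℤP.∣i-j∣≤∣i∣+∣j∣ (⟦ c ⟧ + ⟦ a ⟧) ⟦ b ⟧) ⟩
      ∣ ⟦ c′ ⟧ ∣ ℕ.+ (∣ ⟦ c ⟧ + ⟦ a ⟧ ∣ ℕ.+ ∣ ⟦ b ⟧ ∣)      ≤⟨ ℕP.+-monoʳ-≤ ∣ ⟦ c′ ⟧ ∣ (ℕP.+-monoˡ-≤ ∣ ⟦ b ⟧ ∣ (ℤP.∣i+j∣≤∣i∣+∣j∣ ⟦ c ⟧ ⟦ a ⟧)) ⟩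
      ∣ ⟦ c′ ⟧ ∣ ℕ.+ (∣ ⟦ c ⟧ ∣ ℕ.+ ∣ ⟦ a ⟧ ∣ ℕ.+ ∣ ⟦ b ⟧ ∣) ≤⟨ ℕP.+-mono-≤ (∣⟦s⟧∣≤1 c′) (ℕP.+-mono-≤ (ℕP.+-mono-≤ (∣⟦s⟧∣≤1 c) (∣⟦s⟧∣≤1 a)) (∣⟦s⟧∣≤1 b)) ⟩
      4                                                      <⟨ 4<n ⟩
      n                                                      ∎

  rectangle-columns : ∀ {t t′} → MaxInnerDist n t → MaxInnerDist n t′ → ((x : Fin n) → Far n (t x) (t′ x)) →
                      ColumnSteps (column-class t t′) (steps t′) (steps t)
  rectangle-columns {t} {t′} far far′ vertical = column-steps step
    where
    open ≈-Reasoning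
    c : ℕ → Step
    c = column-class t t′
    vertical-at : ∀ {i} → i < n → + at t′ i ≈ + at t i + (M + ⟦ c i ⟧)
    vertical-at {i} i<n =
      far-step (subst₂ (Far n) (sym (at-fromℕ< t i<n)) (sym (at-fromℕ< t′ i<n)) (vertical (fromℕ< i<n)))
    regroup₁ : ∀ T M e c′ → T + (M + e) + M + c′ ≡ T + (M + e) + (M + c′)
    regroup₁ = solve-∀
    regroup₂ : ∀ T M e c e′ → T + (M + c) + (M + e′) ≡ T + (M + e) + M + (c + e′ - e)
    regroup₂ = solve-∀
    step : ∀ i → suc i < n → ColumnStep (c i) (c (suc i)) (steps t′ i) (steps t i)
    step i lt = exact-column-step {c i} {c (suc i)} {steps t′ i} {steps t i} (≈-cancelˡ X (begin
      X + ⟦ c (suc i) ⟧                                      ≡⟨ regroup₁ (+ at t i) M ⟦ steps t i ⟧ ⟦ c (suc i) ⟧ ⟩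
      + at t i + (M + ⟦ steps t i ⟧) + (M + ⟦ c (suc i) ⟧)  ≈⟨ ≈-+ (≈-sym (far-step (adjacent-far {t} far lt))) (≈-refl {M + ⟦ c (suc i) ⟧}) ⟩
      + at t (suc i) + (M + ⟦ c (suc i) ⟧)                   ≈⟨ ≈-sym (vertical-at {suc i} lt) ⟩
      + at t′ (suc i)                                        ≈⟨ far-step (adjacent-far {t′} far′ lt) ⟩
      + at t′ i + (M + ⟦ steps t′ i ⟧)                       ≈⟨ ≈-+ (vertical-at {i} (ℕP.<⇒≤ lt)) (≈-refl {M + ⟦ steps t′ i ⟧}) ⟩
      + at t i + (M + ⟦ c i ⟧) + (M + ⟦ steps t′ i ⟧)       ≡⟨ regroup₂ (+ at t i) M ⟦ steps t i ⟧ ⟦ c i ⟧ ⟦ steps t′ i ⟧ ⟩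
      X + (⟦ c i ⟧ + ⟦ steps t′ i ⟧ - ⟦ steps t i ⟧)        ∎))
      where
      X : ℤ
      X = + at t i + (M + ⟦ steps t i ⟧) + M

  hDiff-addRow : ∀ c s x y → hDiff n (addRow n c s x) (addRow n c s y) ≡ hDiff n (s x) (s y)
  hDiff-addRow c s x y = %ℕ-cong (begin
    + 1 + + (u y %ℕ n) - (+ 1 + + (u x %ℕ n))
      ≈⟨ ≈-+ (≈-+ (≈-refl {+ 1}) (%ℕ-≈ (u y))) (≈-neg (≈-+ (≈-refl {+ 1}) (%ℕ-≈ (u x)))) ⟩
    + 1 + u y - (+ 1 + u x)       ≡⟨ cancel (+ s y) (+ s x) (+ c) ⟩
    + s y - + s x                 ∎)
    where
    open ≈-Reasoning
    u : Fin n → ℤ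
    u z = + s z - + 1 + + c
    cancel : ∀ a b c → + 1 + (a - + 1 + c) - (+ 1 + (b - + 1 + c)) ≡ a - b
    cancel = solve-∀

  epsilon-step : ∀ c r → MaxInnerDist n (addRow n c r) → ∀ {j j′} → Adj j j′ →
                 epsilon n r j j′ ≡ ⟦ steps (addRow n c r) (toℕ j) ⟧
  epsilon-step c r far {j} {j′} adj = begin
    + hDiff n (r j) (r j′) - + ⌊ n /2⌋      ≡⟨ cong₂ (λ h half → + h - + half) (sym (hDiff-addRow c r j j′)) (sym (ℕP.n≡⌊n+n/2⌋ m)) ⟩
    + hDiff n (t j) (t j′) - M              ≡⟨ cong (_- M) (classify-near (proj₁ near) (proj₂ near)) ⟩
    M + ⟦ classify (hDiff n (t j) (t j′)) ⟧ - M ≡⟨ cancel M _ ⟩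
    ⟦ classify (hDiff n (t j) (t j′)) ⟧    ≡⟨ cong (λ h → ⟦ classify h ⟧) (sym (cong₂ (hDiff n) (at-toℕ t j) next)) ⟩
    ⟦ steps t (toℕ j) ⟧                     ∎
    where
    open ≡-Reasoning
    t : Row n
    t = addRow n c r
    near : m ∸ 1 ≤ hDiff n (t j) (t j′) × hDiff n (t j) (t j′) ≤ suc m
    near = far⇒near {t j} {t j′} (far j j′ adj)
    next : at t (suc (toℕ j)) ≡ t j′
    next = trans (cong (at t) (sym adj)) (at-toℕ t j′)
    cancel : ∀ M x → M + x - M ≡ x
    cancel = solve-∀

  neighbour-steps-close : (r r′ : Row n) → Neighbors n r r′ → (j j′ : Fin n) → Adj j j′ →
    (epsilon n r j j′ ≡ + 1 → epsilon n r′ j j′ ≢ - + 1) ×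
    (epsilon n r j j′ ≡ - + 1 → epsilon n r′ j j′ ≢ + 1)
  neighbour-steps-close r r′ (c , c′ , latin , latin′ , _ , far , far′ , vertical) j j′ adj =
      (λ ε≡1 ε′≡-1 → no-down-up-crossing R′ R C lt (step-of r′ far′ ε′≡-1) (step-of r far ε≡1))
    , (λ ε≡-1 ε′≡1 → no-up-down-crossing R′ R C lt (step-of r′ far′ ε′≡1) (step-of r far ε≡-1))
    where
    R : IsRow (steps (addRow n c r))
    R = latin⇒IsRow latin far
    R′ : IsRow (steps (addRow n c′ r′))
    R′ = latin⇒IsRow latin′ far′
    C : ColumnSteps (column-class (addRow n c r) (addRow n c′ r′)) (steps (addRow n c′ r′)) (steps (addRow n c r))
    C = rectangle-columns far far′ vertical
    lt : suc (toℕ j) < n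
    lt = subst (_< n) adj (FP.toℕ<n j′)
    step-of : ∀ {a} s → MaxInnerDist n (addRow n a s) → ∀ {x} → epsilon n s j j′ ≡ ⟦ x ⟧ → steps (addRow n a s) (toℕ j) ≡ x
    step-of {a} s far-s ε≡ = ⟦⟧-injective (trans (sym (epsilon-step a s far-s adj)) ε≡)

even≥6⇒order : ∀ {n} → 6 ≤ n → 2 ∣ n → ∃ λ k → n ≡ EvenOrder.n k
even≥6⇒order () (ℕ∣.divides 0 refl)
even≥6⇒order (s≤s (s≤s ())) (ℕ∣.divides 1 refl)
even≥6⇒order (s≤s (s≤s (s≤s (s≤s ())))) (ℕ∣.divides 2 refl)
even≥6⇒order _ (ℕ∣.divides (suc (suc (suc k))) refl) = k , double (3 ℕ.+ k)
  where
  double : ∀ x → x ℕ.* 2 ≡ x ℕ.+ x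
  double = ℕSolver.solve-∀

mainTheorem16 : (n : ℕ) → .{{_ : NonZero n}} → 6 ≤ n → 2 ∣ n →
    (r r' : Row n) →
    LatinRow n r → Normal n r → MaxInnerDist n r →
    LatinRow n r' → Normal n r' → MaxInnerDist n r' →
    Neighbors n r r' →
    (j j' : Fin n) → Adj j j' →
    (epsilon n r j j' ≡ + 1 → epsilon n r' j j' ≢ - + 1) ×
    (epsilon n r j j' ≡ - + 1 → epsilon n r' j j' ≢ + 1)
mainTheorem16 n 6≤n 2∣n r r' _ _ _ _ _ _ neighbours j j' adj with even≥6⇒order 6≤n 2∣n
... | k , refl = EvenOrder.neighbour-steps-close k r r' neighbours j j' adj
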